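{- For all $r,u,m,n\in\mathbb{N}$ and $i\in\{0,1\}$, $$D_{r,u,m}(n)=\binom{r}{u}\binom{n}{m}D_{r-u}(n-m)\quad\text{and}\quad D^{(i)}_{r,u,m}(n)=\binom{r}{u}\binom{n}{m}D^{(i)}_{r-u}(n-m).$$
   Context: $\mathbb{N}$ denotes the non-negative integers, $\mathcal{S}_N$ the permutations of $\{1,\ldots,N\}$, cycles are those of the disjoint cycle decomposition (fixed points as 1-cycles), and a permutation has parity $0$ if even and $1$ if odd. $\mathcal{D}_{r,u,m}(n)$ is the set of $\sigma\in\mathcal{S}_{r+n}$ such that any two distinct elements of $\{1,\ldots,r\}$ lie in different cycles of $\sigma$, exactly $u$ elements of $\{1,\ldots,r\}$ are fixed by $\sigma$, and exactly $m$ elements of $\{r+1,\ldots,r+n\}$ are fixed by $\sigma$; $D_{r,u,m}(n)$ is its cardinality and $D^{(i)}_{r,u,m}(n)$ the number of its elements of parity $i$. $D_r(n)=D_{r,0,0}(n)$ and $D^{(i)}_r(n)=D^{(i)}_{r,0,0}(n)$ (the numbers of ($r$-)derangements: fixed-point-free permutations of $\{1,\ldots,r+n\}$ in which elements of $\{1,\ldots,r\}$ lie in pairwise different cycles, resp. of parity $i$). Binomial coefficients $\binom{a}{b}$ with $b>a$ are $0$, and the right-hand sides are read as $0$ in that case. -}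

module Defs where

open import Data.Nat using (ℕ; zero; suc; _+_; _<_; _%_; _≟_)
open import Data.Nat.Properties using (_<?_)
open import Data.Fin using (Fin; toℕ) renaming (_≟_ to _≟ᶠ_; _<?_ to _<ᶠ?_; _<_ to _<ᶠ_)
open import Data.Fin.Properties using (all?; any?)
open import Data.Vec using (Vec; []; _∷_; lookup)
open import Data.List using (List; []; _∷_; length; filter; concatMap; map; allFin)
open import Data.Product using (Σ; _×_; _,_; ∃)
open import Relation.Nullary using (¬_; Dec)
open import Relation.Nullary.Decidable using (_×-dec_; _→-dec_; ¬?)
open import Relation.Binary.PropositionalEquality using (_≡_; _≢_)

-- A candidate map on {1,…,N} (encoded as Fin N, element k+1 ↦ index k)
-- is stored as its table of values: σ(i) = lookup σ i.
Map : ℕ → Set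
Map N = Vec (Fin N) N

tables : (N k : ℕ) → List (Vec (Fin N) k)
tables N zero    = [] ∷ []
tables N (suc k) = concatMap (λ x → map (x ∷_) (tables N k)) (allFin N)

allMaps : (N : ℕ) → List (Map N)
allMaps N = tables N N

-- σ is a permutation (injective, hence bijective on the finite set)
IsPerm : ∀ {N} → Map N → Set
IsPerm {N} σ = (i j : Fin N) → lookup σ i ≡ lookup σ j → i ≡ j

isPerm? : ∀ {N} (σ : Map N) → Dec (IsPerm σ)
isPerm? σ = all? λ i → all? λ j → (lookup σ i ≟ᶠ lookup σ j) →-dec (i ≟ᶠ j)

iter : ∀ {N} → Map N → ℕ → Fin N → Fin N
iter σ zero    i = i
iter σ (suc k) i = lookup σ (iter σ k i)

-- i and j lie in the same cycle of σ: j = σ^k(i) for some k.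
-- (For a permutation of an N-element set, k < N suffices.)
SameCycle : ∀ {N} → Map N → Fin N → Fin N → Set
SameCycle {N} σ i j = ∃ λ (k : Fin N) → iter σ (toℕ k) i ≡ j

sameCycle? : ∀ {N} (σ : Map N) (i j : Fin N) → Dec (SameCycle σ i j)
sameCycle? σ i j = any? λ k → iter σ (toℕ k) i ≟ᶠ j

-- "the first r elements" = {1,…,r} = indices with toℕ i < r
-- any two distinct elements of {1,…,r} lie in different cycles
Separated : ∀ {N} → ℕ → Map N → Set
Separated {N} r σ = (i j : Fin N) → toℕ i < r → toℕ j < r → i ≢ j → ¬ SameCycle σ i j

separated? : ∀ {N} (r : ℕ) (σ : Map N) → Dec (Separated r σ)
separated? r σ = all? λ i → all? λ j →
  (toℕ i <? r) →-dec ((toℕ j <? r) →-dec (¬? (i ≟ᶠ j) →-dec ¬? (sameCycle? σ i j)))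

fixedLow : ∀ {N} → ℕ → Map N → ℕ
fixedLow {N} r σ = length (filter (λ i → (toℕ i <? r) ×-dec (lookup σ i ≟ᶠ i)) (allFin N))

fixedHigh : ∀ {N} → ℕ → Map N → ℕ
fixedHigh {N} r σ = length (filter (λ i → ¬? (toℕ i <? r) ×-dec (lookup σ i ≟ᶠ i)) (allFin N))

inversions : ∀ {N} → Map N → ℕ
inversions {N} σ =
  length (filter (λ { (i , j) → (i <ᶠ? j) ×-dec (lookup σ j <ᶠ? lookup σ i) })
                 (concatMap (λ i → map (i ,_) (allFin N)) (allFin N)))

parity : ∀ {N} → Map N → ℕ
parity σ = inversions σ % 2

InD : (r u m n : ℕ) → Map (r + n) → Set
InD r u m n σ = IsPerm σ × Separated r σ × fixedLow r σ ≡ u × fixedHigh r σ ≡ m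

inD? : (r u m n : ℕ) (σ : Map (r + n)) → Dec (InD r u m n σ)
inD? r u m n σ = isPerm? σ ×-dec separated? r σ ×-dec (fixedLow r σ ≟ u) ×-dec (fixedHigh r σ ≟ m)

D : (r u m n : ℕ) → ℕ
D r u m n = length (filter (inD? r u m n) (allMaps (r + n)))

Dpar : (i r u m n : ℕ) → ℕ
Dpar i r u m n = length (filter (λ σ → inD? r u m n σ ×-dec (parity σ ≟ i)) (allMaps (r + n)))

Dr : (r n : ℕ) → ℕ
Dr r n = D r 0 0 n

Drpar : (i r n : ℕ) → ℕ
Drpar i r n = Dpar i r 0 0 n

{-# OPTIONS --safe #-}
-- Double counting the pairs (σ, p) with p a fixed point of σ gives the recurrences
--   (u+1) D_{r,u+1,m}(n) = r D_{r-1,u,m}(n)   and   (m+1) D_{r,u,m+1}(n) = n D_{r,u,m}(n-1),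
-- since deleting p maps the σ fixing p bijectively onto the permutations of one point fewer
-- with one fixed point fewer among, resp. outside, the first r points. Deleting a fixed point
-- keeps the first r points in distinct cycles, and it preserves parity: the inversions through
-- p are the points that τ carries across p, downwards or upwards, and there are as many of each.
-- With (k+1) C(n+1,k+1) = (n+1) C(n,k), induction on u and m gives the closed form.

module Submission where

open import Defs
open import Data.Nat using (ℕ; _*_; _∸_; _<_)
open import Data.Nat.Combinatorics using (_C_)
open import Data.Product using (_×_)
open import Relation.Binary.PropositionalEquality using (_≡_)

open import Data.Nat using (zero; suc; _+_; _%_; _≤_; pred; z≤n; s≤s; s≤s⁻¹; z<s; _≟_)
open import Data.Nat.Properties
  using ( +-*-semiring; _<?_; ≰⇒>; <⇒≱; ≮⇒≥; <-≤-trans; m<n⇒m<1+n; ≤-trans; <-trans; n<1+n; ≤-reflexive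
        ; ≤-antisym; +-monoʳ-<; +-monoʳ-≤; m∸n+n≡m; +-cancelˡ-≡; +-cancelʳ-≤; <-irrefl; *-zeroʳ; *-identityʳ
        ; *-identityˡ; *-distribˡ-+; *-cancelˡ-≡; m+n∸m≡n; +-suc; m≤m+n; +-identityʳ)
open import Data.Nat.Induction using (<-rec)
open import Data.Nat.DivMod using ([m+kn]%n≡m%n)
open import Data.Nat.Combinatorics using (nCk+nC[k+1]≡[n+1]C[k+1]; nC1≡n)
open import Data.Nat.Tactic.RingSolver using (solve-∀)
open import Algebra.Properties.Semiring.Sum +-*-semiring
  using (sum-syntax; sum-cong-≗; sum-replicate-zero; sum-remove; ∑-distrib-+; *-distribʳ-sum)
open import Data.Fin using (Fin; toℕ; punchIn; punchOut; fromℕ<)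
  renaming (zero to fzero; suc to fsuc; _<?_ to _<ᶠ?_)
open import Data.Fin.Properties
  using (punchIn-injective; punchInᵢ≢i; punchIn-punchOut; punchIn-mono-≤; punchIn-cancel-≤; toℕ-fromℕ<; toℕ<n; pigeonhole)
  renaming (_≟_ to _≟ᶠ_)
open import Data.Vec as Vec using (Vec; []; _∷_; lookup)
open import Data.Vec.Properties using (∷-injective; lookup∘tabulate; tabulate∘lookup; tabulate-cong)
open import Data.List using (List; []; _∷_; _++_; length; filter; map; concatMap; tabulate; allFin; cartesianProductWith)
open import Data.List.Properties using (length-removeAt′; map-tabulate; filter-++; length-++; filter-≐; filter-none)
open import Data.List.Relation.Unary.Any using (here; there; index; _─_)
open import Data.List.Relation.Unary.All as All using (universal)
open import Data.List.Relation.Unary.AllPairs as AllPairs using (_∷_)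
open import Data.List.Relation.Unary.Unique.Propositional using (Unique)
import Data.List.Relation.Unary.Unique.Propositional.Properties as Unique
open import Data.List.Membership.Propositional using (_∈_)
open import Data.List.Membership.Propositional.Properties using (∈-filter⁺; ∈-filter⁻; ∈-allFin; ∈-cartesianProductWith⁺)
open import Data.Product using (∃; _,_; proj₁; proj₂)
open import Data.Product.Function.NonDependent.Propositional using (_×-⇔_)
open import Data.Sum using (_⊎_; inj₁; inj₂)
open import Data.Empty using (⊥-elim)
open import Data.Unit using (tt)
open import Function using (_∘_; _∘′_; id; _⇔_; mk⇔; Equivalence)
open import Function.Properties.Equivalence using () renaming (trans to ⇔-trans)
open import Level using (0ℓ)
open import Relation.Nullary using (¬_; Dec; yes; no)
open import Relation.Nullary.Decidable using (¬?; _×-dec_)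
open import Relation.Unary using (Pred; Decidable; _≐_)
open import Relation.Unary.Properties using (_∩?_)
open import Relation.Binary.PropositionalEquality

-- Indicators and finite sums

𝟙 : {A : Set} → Dec A → ℕ
𝟙 (yes _) = 1
𝟙 (no _)  = 0

𝟙-yes : {A : Set} (a? : Dec A) → A → 𝟙 a? ≡ 1
𝟙-yes (yes _) _ = refl
𝟙-yes (no ¬a) a = ⊥-elim (¬a a)

𝟙-no : {A : Set} (a? : Dec A) → ¬ A → 𝟙 a? ≡ 0
𝟙-no (yes a) ¬a = ⊥-elim (¬a a)
𝟙-no (no _)  _  = refl

𝟙-cong : {A B : Set} → A ⇔ B → (a? : Dec A) (b? : Dec B) → 𝟙 a? ≡ 𝟙 b?
𝟙-cong A⇔B a? (yes b) = 𝟙-yes a? (Equivalence.from A⇔B b)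
𝟙-cong A⇔B a? (no ¬b) = 𝟙-no a? (¬b ∘ Equivalence.to A⇔B)

𝟙+𝟙¬ : {A : Set} (a? : Dec A) → 𝟙 a? + 𝟙 (¬? a?) ≡ 1
𝟙+𝟙¬ (yes _) = refl
𝟙+𝟙¬ (no _)  = refl

∑-const : ∀ n c → ∑[ i < n ] c ≡ n * c
∑-const zero    c = refl
∑-const (suc n) c = cong (c +_) (∑-const n c)

∑𝟙+∑𝟙¬ : ∀ {n} {A : Fin n → Set} (A? : ∀ i → Dec (A i)) →
  ∑[ i < n ] 𝟙 (A? i) + ∑[ i < n ] 𝟙 (¬? (A? i)) ≡ n
∑𝟙+∑𝟙¬ {n} A? = begin
  ∑[ i < n ] 𝟙 (A? i) + ∑[ i < n ] 𝟙 (¬? (A? i)) ≡⟨ ∑-distrib-+ (𝟙 ∘ A?) (𝟙 ∘ ¬? ∘ A?) ⟨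
  ∑[ i < n ] (𝟙 (A? i) + 𝟙 (¬? (A? i)))          ≡⟨ sum-cong-≗ {n} (𝟙+𝟙¬ ∘ A?) ⟩
  ∑[ i < n ] 1                                    ≡⟨ ∑-const n 1 ⟩
  n * 1                                           ≡⟨ *-identityʳ n ⟩
  n                                               ∎
  where open ≡-Reasoning

∑𝟙-<-toℕ : ∀ {n} k → k ≤ n → ∑[ i < n ] 𝟙 (toℕ i <? k) ≡ k
∑𝟙-<-toℕ {n} zero _ = trans (sum-cong-≗ {n} (λ i → 𝟙-no (toℕ i <? 0) λ ())) (sum-replicate-zero n)
∑𝟙-<-toℕ {suc n} (suc k) (s≤s k≤n) = cong₂ _+_
  (𝟙-yes (0 <? suc k) (s≤s z≤n))
  (trans (sum-cong-≗ {n} λ i → 𝟙-cong (mk⇔ s≤s⁻¹ s≤s) (suc (toℕ i) <? suc k) (toℕ i <? k))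
         (∑𝟙-<-toℕ k k≤n))

-- Counting by filtering lists

module _ {A : Set} {P : Pred A 0ℓ} (P? : Decidable P) where

  length-filter-∷ : ∀ x xs → length (filter P? (x ∷ xs)) ≡ 𝟙 (P? x) + length (filter P? xs)
  length-filter-∷ x xs with P? x
  ... | yes _ = refl
  ... | no _  = refl

  length-filter-tabulate : ∀ {n} (f : Fin n → A) → length (filter P? (tabulate f)) ≡ ∑[ i < n ] 𝟙 (P? (f i))
  length-filter-tabulate {zero}  f = refl
  length-filter-tabulate {suc n} f =
    trans (length-filter-∷ (f fzero) _) (cong (𝟙 (P? (f fzero)) +_) (length-filter-tabulate (f ∘ fsuc)))

  length-filter-concatMap : {B : Set} (g : B → List A) → ∀ {n} (f : Fin n → B) →
    length (filter P? (concatMap g (tabulate f))) ≡ ∑[ i < n ] length (filter P? (g (f i)))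
  length-filter-concatMap g {zero}  f = refl
  length-filter-concatMap g {suc n} f = begin
    length (filter P? (g (f fzero) ++ concatMap g (tabulate (f ∘ fsuc))))
      ≡⟨ cong length (filter-++ P? (g (f fzero)) _) ⟩
    length (filter P? (g (f fzero)) ++ filter P? (concatMap g (tabulate (f ∘ fsuc))))
      ≡⟨ length-++ (filter P? (g (f fzero))) ⟩
    length (filter P? (g (f fzero))) + length (filter P? (concatMap g (tabulate (f ∘ fsuc))))
      ≡⟨ cong (length (filter P? (g (f fzero))) +_) (length-filter-concatMap g (f ∘ fsuc)) ⟩
    ∑[ i < suc n ] length (filter P? (g (f i))) ∎
    where open ≡-Reasoning

∈-─⁺ : {A : Set} {x y : A} {xs : List A} (x∈xs : x ∈ xs) → y ∈ xs → y ≢ x → y ∈ (xs ─ x∈xs)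
∈-─⁺ (here refl) (here refl) y≢x = ⊥-elim (y≢x refl)
∈-─⁺ (here refl) (there y∈xs) _ = y∈xs
∈-─⁺ (there _) (here y≡x) _ = here y≡x
∈-─⁺ (there x∈xs) (there y∈xs) y≢x = there (∈-─⁺ x∈xs y∈xs y≢x)

length-≤-injection : {A B : Set} {xs : List A} {ys : List B} (f : A → B) → Unique xs →
  (∀ {x} → x ∈ xs → f x ∈ ys) → (∀ {x y} → x ∈ xs → y ∈ xs → f x ≡ f y → x ≡ y) →
  length xs ≤ length ys
length-≤-injection {xs = []} f _ _ _ = z≤n
length-≤-injection {xs = x ∷ xs} {ys} f (x∉xs ∷ xs!) into inj =
  ≤-trans (s≤s (length-≤-injection f xs! into′ (λ p q → inj (there p) (there q))))
          (≤-reflexive (sym (length-removeAt′ ys (index fx∈ys))))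
  where
  fx∈ys : f x ∈ ys
  fx∈ys = into (here refl)
  into′ : ∀ {y} → y ∈ xs → f y ∈ (ys ─ fx∈ys)
  into′ y∈xs = ∈-─⁺ fx∈ys (into (there y∈xs))
    λ fy≡fx → All.lookup x∉xs y∈xs (inj (here refl) (there y∈xs) (sym fy≡fx))

length-filter-≤ : {A B : Set} {P : Pred A 0ℓ} {Q : Pred B 0ℓ} (P? : Decidable P) (Q? : Decidable Q)
  {xs : List A} {ys : List B} → Unique xs → (∀ y → y ∈ ys) → (f : A → B) → (∀ {x} → P x → Q (f x)) →
  (∀ {x y} → P x → P y → f x ≡ f y → x ≡ y) → length (filter P? xs) ≤ length (filter Q? ys)
length-filter-≤ {P = P} P? Q? {xs} xs! ys-complete f P⇒Qf inj = length-≤-injection f (Unique.filter⁺ P? xs!)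
  (λ x∈ → ∈-filter⁺ Q? (ys-complete _) (P⇒Qf (satisfies x∈)))
  (λ x∈ y∈ → inj (satisfies x∈) (satisfies y∈))
  where
  satisfies : ∀ {x} → x ∈ filter P? xs → P x
  satisfies x∈ = proj₂ (∈-filter⁻ P? {xs = xs} x∈)

length-filter-bijection : {A B : Set} {P : Pred A 0ℓ} {Q : Pred B 0ℓ} (P? : Decidable P) (Q? : Decidable Q)
  {xs : List A} {ys : List B} → Unique xs → Unique ys → (∀ x → x ∈ xs) → (∀ y → y ∈ ys) →
  (f : A → B) (g : B → A) → (∀ {x} → P x → Q (f x)) → (∀ {y} → Q y → P (g y)) →
  (∀ {x} → P x → g (f x) ≡ x) → (∀ {y} → Q y → f (g y) ≡ y) →
  length (filter P? xs) ≡ length (filter Q? ys)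
length-filter-bijection P? Q? xs! ys! xs-complete ys-complete f g P⇒Qf Q⇒Pg gf fg = ≤-antisym
  (length-filter-≤ P? Q? xs! ys-complete f P⇒Qf
    λ Px Py fx≡fy → trans (sym (gf Px)) (trans (cong g fx≡fy) (gf Py)))
  (length-filter-≤ Q? P? ys! xs-complete g Q⇒Pg
    λ Qx Qy gx≡gy → trans (sym (fg Qx)) (trans (cong f gx≡gy) (fg Qy)))

module _ {A : Set} {P : Pred A 0ℓ} {n} {F : Fin n → Pred A 0ℓ} (P? : Decidable P) (F? : ∀ i → Decidable (F i)) where

  double-count : (c : ℕ) → (∀ {x} → P x → ∑[ i < n ] 𝟙 (F? i x) ≡ c) →
    ∀ xs → c * length (filter P? xs) ≡ ∑[ i < n ] length (filter (P? ∩? F? i) xs)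
  double-count c count-F [] = trans (*-zeroʳ c) (sym (sum-replicate-zero n))
  double-count c count-F (x ∷ xs) = begin
    c * length (filter P? (x ∷ xs))                  ≡⟨ cong (c *_) (length-filter-∷ P? x xs) ⟩
    c * (𝟙 (P? x) + length (filter P? xs))           ≡⟨ *-distribˡ-+ c (𝟙 (P? x)) _ ⟩
    c * 𝟙 (P? x) + c * length (filter P? xs)         ≡⟨ cong₂ _+_ (contribution x) (double-count c count-F xs) ⟩
    ∑[ i < n ] 𝟙 (P? x ×-dec F? i x) + ∑[ i < n ] length (filter (P? ∩? F? i) xs)
      ≡⟨ ∑-distrib-+ (λ i → 𝟙 (P? x ×-dec F? i x)) _ ⟨
    ∑[ i < n ] (𝟙 (P? x ×-dec F? i x) + length (filter (P? ∩? F? i) xs))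
      ≡⟨ sum-cong-≗ {n} (λ i → sym (length-filter-∷ (P? ∩? F? i) x xs)) ⟩
    ∑[ i < n ] length (filter (P? ∩? F? i) (x ∷ xs)) ∎
    where
    open ≡-Reasoning
    contribution : ∀ x → c * 𝟙 (P? x) ≡ ∑[ i < n ] 𝟙 (P? x ×-dec F? i x)
    contribution x with P? x
    ... | yes Px = trans (*-identityʳ c) (trans (sym (count-F Px))
                     (sum-cong-≗ {n} λ i → 𝟙-cong (mk⇔ (Px ,_) proj₂) (F? i x) (yes Px ×-dec F? i x)))
    ... | no ¬Px = trans (*-zeroʳ c) (trans (sym (sum-replicate-zero n))
                     (sum-cong-≗ {n} λ i → sym (𝟙-no (no ¬Px ×-dec F? i x) (¬Px ∘ proj₁))))

concatMap-prepend : ∀ {A : Set} {k} (xs : List A) (vs : List (Vec A k)) →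
  concatMap (λ x → map (x ∷_) vs) xs ≡ cartesianProductWith _∷_ xs vs
concatMap-prepend []       vs = refl
concatMap-prepend (x ∷ xs) vs = cong (map (x ∷_) vs ++_) (concatMap-prepend xs vs)

tables-unique : ∀ N k → Unique (tables N k)
tables-unique N zero    = All.[] AllPairs.∷ AllPairs.[]
tables-unique N (suc k) = subst Unique (sym (concatMap-prepend (allFin N) (tables N k)))
  (Unique.cartesianProductWith⁺ _∷_ ∷-injective (Unique.allFin⁺ N) (tables-unique N k))

tables-complete : ∀ {N k} (v : Vec (Fin N) k) → v ∈ tables N k
tables-complete []                = here refl
tables-complete {N} {suc k} (x ∷ v) = subst (x ∷ v ∈_) (sym (concatMap-prepend (allFin N) (tables N k)))
  (∈-cartesianProductWith⁺ _∷_ (∈-allFin x) (tables-complete v))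

-- Inserting and deleting a fixed point

toℕ-punchIn-< : ∀ {n} (p : Fin (suc n)) (j : Fin n) → toℕ j < toℕ p → toℕ (punchIn p j) ≡ toℕ j
toℕ-punchIn-< fzero    j        ()
toℕ-punchIn-< (fsuc p) fzero    _         = refl
toℕ-punchIn-< (fsuc p) (fsuc j) (s≤s j<p) = cong suc (toℕ-punchIn-< p j j<p)

toℕ-punchIn-≥ : ∀ {n} (p : Fin (suc n)) (j : Fin n) → toℕ p ≤ toℕ j → toℕ (punchIn p j) ≡ suc (toℕ j)
toℕ-punchIn-≥ fzero    j        _         = refl
toℕ-punchIn-≥ (fsuc p) fzero    ()
toℕ-punchIn-≥ (fsuc p) (fsuc j) (s≤s p≤j) = cong suc (toℕ-punchIn-≥ p j p≤j)

punchIn-<-pivot : ∀ {n} (p : Fin (suc n)) (j : Fin n) → toℕ (punchIn p j) < toℕ p ⇔ toℕ j < toℕ p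
punchIn-<-pivot fzero    j        = mk⇔ (λ ()) (λ ())
punchIn-<-pivot (fsuc p) fzero    = mk⇔ (λ _ → z<s) (λ _ → z<s)
punchIn-<-pivot (fsuc p) (fsuc j) = mk⇔ (s≤s ∘ Equivalence.to (punchIn-<-pivot p j) ∘ s≤s⁻¹)
                                         (s≤s ∘ Equivalence.from (punchIn-<-pivot p j) ∘ s≤s⁻¹)

pivot-<-punchIn : ∀ {n} (p : Fin (suc n)) (j : Fin n) → toℕ p < toℕ (punchIn p j) ⇔ (¬ toℕ j < toℕ p)
pivot-<-punchIn fzero    j        = mk⇔ (λ _ ()) (λ _ → z<s)
pivot-<-punchIn (fsuc p) fzero    = mk⇔ (λ ()) (λ j≮p → ⊥-elim (j≮p z<s))
pivot-<-punchIn (fsuc p) (fsuc j) = mk⇔ (λ p<j j<p → Equivalence.to (pivot-<-punchIn p j) (s≤s⁻¹ p<j) (s≤s⁻¹ j<p))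
                                         (λ j≮p → s≤s (Equivalence.from (pivot-<-punchIn p j) (j≮p ∘ s≤s)))

punchIn-<-punchIn : ∀ {n} (p : Fin (suc n)) (i j : Fin n) → toℕ (punchIn p i) < toℕ (punchIn p j) ⇔ toℕ i < toℕ j
punchIn-<-punchIn p i j = mk⇔ (λ lt → ≰⇒> λ j≤i → <⇒≱ lt (punchIn-mono-≤ p j i j≤i))
                              (λ lt → ≰⇒> λ pj≤pi → <⇒≱ lt (punchIn-cancel-≤ p j i pj≤pi))

punchIn-<-below : ∀ {n r} (p : Fin (suc n)) (j : Fin n) → toℕ p < suc r → toℕ (punchIn p j) < suc r ⇔ toℕ j < r
punchIn-<-below p j p<1+r with toℕ j <? toℕ p
... | yes j<p rewrite toℕ-punchIn-< p j j<p = mk⇔ (λ _ → <-≤-trans j<p (s≤s⁻¹ p<1+r)) m<n⇒m<1+n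
... | no  j≮p rewrite toℕ-punchIn-≥ p j (≮⇒≥ j≮p) = mk⇔ s≤s⁻¹ s≤s

punchIn-<-above : ∀ {n r} (p : Fin (suc n)) (j : Fin n) → r ≤ toℕ p → toℕ (punchIn p j) < r ⇔ toℕ j < r
punchIn-<-above p j r≤p with toℕ j <? toℕ p
... | yes j<p rewrite toℕ-punchIn-< p j j<p = mk⇔ id id
... | no  j≮p rewrite toℕ-punchIn-≥ p j (≮⇒≥ j≮p) =
  mk⇔ (λ 1+j<r → ⊥-elim (<⇒≱ (<-trans (n<1+n _) 1+j<r) r≤j)) (λ j<r → ⊥-elim (<⇒≱ j<r r≤j))
  where r≤j = ≤-trans r≤p (≮⇒≥ j≮p)

pivot-or-punchIn : ∀ {n} (p x : Fin (suc n)) → x ≡ p ⊎ ∃ λ j → x ≡ punchIn p j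
pivot-or-punchIn p x with p ≟ᶠ x
... | yes p≡x = inj₁ (sym p≡x)
... | no  p≢x = inj₂ (punchOut p≢x , sym (punchIn-punchOut p≢x))

liftAt : ∀ {n} → Fin (suc n) → (Fin n → Fin n) → Fin (suc n) → Fin (suc n)
liftAt p f x with p ≟ᶠ x
... | yes _   = p
... | no  p≢x = punchIn p (f (punchOut p≢x))

liftAt-pivot : ∀ {n} (p : Fin (suc n)) (f : Fin n → Fin n) → liftAt p f p ≡ p
liftAt-pivot p f with p ≟ᶠ p
... | yes _   = refl
... | no  p≢p = ⊥-elim (p≢p refl)

liftAt-punchIn : ∀ {n} (p : Fin (suc n)) (f : Fin n → Fin n) j → liftAt p f (punchIn p j) ≡ punchIn p (f j)
liftAt-punchIn p f j with p ≟ᶠ punchIn p j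
... | yes p≡pj = ⊥-elim (punchInᵢ≢i p j (sym p≡pj))
... | no  p≢pj = cong (punchIn p ∘ f) (punchIn-injective p _ _ (punchIn-punchOut p≢pj))

-- punchOut p y, with the junk value d when y = p.
punchOutOr : ∀ {n} (p y : Fin (suc n)) → Fin n → Fin n
punchOutOr p y d with p ≟ᶠ y
... | yes _   = d
... | no  p≢y = punchOut p≢y

punchIn-punchOutOr : ∀ {n} {p y : Fin (suc n)} (d : Fin n) → p ≢ y → punchIn p (punchOutOr p y d) ≡ y
punchIn-punchOutOr {p = p} {y} d p≢y with p ≟ᶠ y
... | yes p≡y = ⊥-elim (p≢y p≡y)
... | no  p≢y = punchIn-punchOut p≢y

insertFix : ∀ {N} → Fin (suc N) → Map N → Map (suc N)
insertFix p τ = Vec.tabulate (liftAt p (lookup τ))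

deleteFix : ∀ {N} → Fin (suc N) → Map (suc N) → Map N
deleteFix p σ = Vec.tabulate λ j → punchOutOr p (lookup σ (punchIn p j)) j

module _ {N} (p : Fin (suc N)) where

  insertFix-pivot : ∀ τ → lookup (insertFix p τ) p ≡ p
  insertFix-pivot τ = trans (lookup∘tabulate (liftAt p (lookup τ)) p) (liftAt-pivot p (lookup τ))

  insertFix-punchIn : ∀ τ j → lookup (insertFix p τ) (punchIn p j) ≡ punchIn p (lookup τ j)
  insertFix-punchIn τ j = trans (lookup∘tabulate (liftAt p (lookup τ)) (punchIn p j)) (liftAt-punchIn p (lookup τ) j)

  deleteFix-insertFix : ∀ τ → deleteFix p (insertFix p τ) ≡ τ
  deleteFix-insertFix τ = trans (tabulate-cong λ j → punchIn-injective p _ _ (begin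
    punchIn p (punchOutOr p (lookup (insertFix p τ) (punchIn p j)) j)
      ≡⟨ punchIn-punchOutOr j (λ p≡σj → punchInᵢ≢i p _ (sym (trans p≡σj (insertFix-punchIn τ j)))) ⟩
    lookup (insertFix p τ) (punchIn p j) ≡⟨ insertFix-punchIn τ j ⟩
    punchIn p (lookup τ j) ∎)) (tabulate∘lookup τ)
    where open ≡-Reasoning

  insertFix-deleteFix : ∀ σ → IsPerm σ → lookup σ p ≡ p → insertFix p (deleteFix p σ) ≡ σ
  insertFix-deleteFix σ σ-inj σp≡p = trans (tabulate-cong agree) (tabulate∘lookup σ)
    where
    agree : ∀ x → liftAt p (lookup (deleteFix p σ)) x ≡ lookup σ x
    agree x with pivot-or-punchIn p x
    ... | inj₁ refl = trans (liftAt-pivot p _) (sym σp≡p)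
    ... | inj₂ (j , refl) = begin
      liftAt p (lookup (deleteFix p σ)) (punchIn p j) ≡⟨ liftAt-punchIn p _ j ⟩
      punchIn p (lookup (deleteFix p σ) j)             ≡⟨ cong (punchIn p) (lookup∘tabulate _ j) ⟩
      punchIn p (punchOutOr p (lookup σ (punchIn p j)) j)
        ≡⟨ punchIn-punchOutOr j (λ p≡σj → punchInᵢ≢i p j (sym (σ-inj _ _ (trans σp≡p p≡σj)))) ⟩
      lookup σ (punchIn p j) ∎
      where open ≡-Reasoning

  insertFix-isPerm : ∀ τ → IsPerm (insertFix p τ) ⇔ IsPerm τ
  insertFix-isPerm τ = mk⇔ reflect preserve
    where
    reflect : IsPerm (insertFix p τ) → IsPerm τ
    reflect σ-inj i j τi≡τj = punchIn-injective p i j (σ-inj _ _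
      (trans (insertFix-punchIn τ i) (trans (cong (punchIn p) τi≡τj) (sym (insertFix-punchIn τ j)))))
    preserve : IsPerm τ → IsPerm (insertFix p τ)
    preserve τ-inj x y σx≡σy with pivot-or-punchIn p x | pivot-or-punchIn p y
    ... | inj₁ refl       | inj₁ refl       = refl
    ... | inj₁ refl       | inj₂ (j , refl) = ⊥-elim (punchInᵢ≢i p _
            (sym (trans (sym (insertFix-pivot τ)) (trans σx≡σy (insertFix-punchIn τ j)))))
    ... | inj₂ (i , refl) | inj₁ refl       = ⊥-elim (punchInᵢ≢i p _
            (trans (sym (insertFix-punchIn τ i)) (trans σx≡σy (insertFix-pivot τ))))
    ... | inj₂ (i , refl) | inj₂ (j , refl) = cong (punchIn p) (τ-inj i j (punchIn-injective p _ _
            (trans (sym (insertFix-punchIn τ i)) (trans σx≡σy (insertFix-punchIn τ j)))))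

-- Cycles

iter-+ : ∀ {N} (σ : Map N) a b i → iter σ (a + b) i ≡ iter σ a (iter σ b i)
iter-+ σ zero    b i = refl
iter-+ σ (suc a) b i = cong (lookup σ) (iter-+ σ a b i)

-- Pigeonhole: among σ⁰ i, …, σᴺ i two agree, so any k ≥ N can be shortened.
iter⇒sameCycle : ∀ {N} (σ : Map N) {i j} k → iter σ k i ≡ j → SameCycle σ i j
iter⇒sameCycle {N} σ {i} {j} = <-rec (λ k → iter σ k i ≡ j → SameCycle σ i j) shorten
  where
  shorten : ∀ k → (∀ {k′} → k′ < k → iter σ k′ i ≡ j → SameCycle σ i j) →
            iter σ k i ≡ j → SameCycle σ i j
  shorten k rec σᵏi≡j with k <? N
  ... | yes k<N = fromℕ< k<N , trans (cong (λ l → iter σ l i) (toℕ-fromℕ< k<N)) σᵏi≡j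
  ... | no  k≮N with a , b , a<b , σᵃi≡σᵇi ← pigeonhole (n<1+n N) (λ t → iter σ (toℕ t) i) =
    rec (<-≤-trans (+-monoʳ-< (k ∸ toℕ b) a<b) (≤-reflexive (m∸n+n≡m b≤k))) (begin
      iter σ (k ∸ toℕ b + toℕ a) i       ≡⟨ iter-+ σ (k ∸ toℕ b) (toℕ a) i ⟩
      iter σ (k ∸ toℕ b) (iter σ (toℕ a) i) ≡⟨ cong (iter σ (k ∸ toℕ b)) σᵃi≡σᵇi ⟩
      iter σ (k ∸ toℕ b) (iter σ (toℕ b) i) ≡⟨ iter-+ σ (k ∸ toℕ b) (toℕ b) i ⟨
      iter σ (k ∸ toℕ b + toℕ b) i       ≡⟨ cong (λ l → iter σ l i) (m∸n+n≡m b≤k) ⟩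
      iter σ k i                          ≡⟨ σᵏi≡j ⟩
      j ∎)
    where
    open ≡-Reasoning
    b≤k : toℕ b ≤ k
    b≤k = ≤-trans (s≤s⁻¹ (toℕ<n b)) (≮⇒≥ k≮N)

module _ {N} (p : Fin (suc N)) (τ : Map N) where

  iter-insertFix-pivot : ∀ k → iter (insertFix p τ) k p ≡ p
  iter-insertFix-pivot zero    = refl
  iter-insertFix-pivot (suc k) = trans (cong (lookup (insertFix p τ)) (iter-insertFix-pivot k)) (insertFix-pivot p τ)

  iter-insertFix-punchIn : ∀ k j → iter (insertFix p τ) k (punchIn p j) ≡ punchIn p (iter τ k j)
  iter-insertFix-punchIn zero    j = refl
  iter-insertFix-punchIn (suc k) j =
    trans (cong (lookup (insertFix p τ)) (iter-insertFix-punchIn k j)) (insertFix-punchIn p τ _)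

  insertFix-separated : ∀ {r r′} → (∀ j → toℕ (punchIn p j) < r ⇔ toℕ j < r′) →
    Separated r (insertFix p τ) ⇔ Separated r′ τ
  insertFix-separated {r} {r′} shift = mk⇔ reflect preserve
    where
    reflect : Separated r (insertFix p τ) → Separated r′ τ
    reflect sep i j i<r′ j<r′ i≢j (k , τᵏi≡j) =
      sep (punchIn p i) (punchIn p j) (Equivalence.from (shift i) i<r′) (Equivalence.from (shift j) j<r′)
        (i≢j ∘′ punchIn-injective p i j)
        (iter⇒sameCycle _ (toℕ k) (trans (iter-insertFix-punchIn (toℕ k) i) (cong (punchIn p) τᵏi≡j)))
    preserve : Separated r′ τ → Separated r (insertFix p τ)
    preserve sep x y x<r y<r x≢y (k , σᵏx≡y) with pivot-or-punchIn p x | pivot-or-punchIn p y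
    ... | inj₁ refl       | _               = x≢y (trans (sym (iter-insertFix-pivot (toℕ k))) σᵏx≡y)
    ... | inj₂ (i , refl) | inj₁ refl       =
      punchInᵢ≢i p _ (trans (sym (iter-insertFix-punchIn (toℕ k) i)) σᵏx≡y)
    ... | inj₂ (i , refl) | inj₂ (j , refl) =
      sep i j (Equivalence.to (shift i) x<r) (Equivalence.to (shift j) y<r) (x≢y ∘′ cong (punchIn p))
        (iter⇒sameCycle τ (toℕ k) (punchIn-injective p _ _ (trans (sym (iter-insertFix-punchIn (toℕ k) i)) σᵏx≡y)))

-- Fixed points and parity

fixedIn : ∀ {N} {R : Pred (Fin N) 0ℓ} → Decidable R → Map N → ℕ
fixedIn {N} R? σ = length (filter (λ i → R? i ×-dec (lookup σ i ≟ᶠ i)) (allFin N))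

fixedIn-insertFix : ∀ {N} (p : Fin (suc N)) (τ : Map N) {R : Pred (Fin (suc N)) 0ℓ} {R′ : Pred (Fin N) 0ℓ}
  (R? : Decidable R) (R′? : Decidable R′) → (∀ j → R (punchIn p j) ⇔ R′ j) →
  fixedIn R? (insertFix p τ) ≡ 𝟙 (R? p) + fixedIn R′? τ
fixedIn-insertFix {N} p τ {R} {R′} R? R′? shift = begin
  fixedIn R? σ                                            ≡⟨ length-filter-tabulate fixσ id ⟩
  ∑[ i < suc N ] 𝟙 (fixσ i)                               ≡⟨ sum-remove {i = p} (𝟙 ∘ fixσ) ⟩
  𝟙 (fixσ p) + ∑[ j < N ] 𝟙 (fixσ (punchIn p j))
    ≡⟨ cong₂ _+_ (𝟙-cong (mk⇔ proj₁ (_, insertFix-pivot p τ)) _ (R? p))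
                 (sum-cong-≗ {N} λ j → 𝟙-cong (shift j ×-⇔ fixed j) _ _) ⟩
  𝟙 (R? p) + ∑[ j < N ] 𝟙 (fixτ j)                        ≡⟨ cong (𝟙 (R? p) +_) (length-filter-tabulate fixτ id) ⟨
  𝟙 (R? p) + fixedIn R′? τ ∎
  where
  open ≡-Reasoning
  σ = insertFix p τ
  fixσ : ∀ i → Dec (R i × lookup σ i ≡ i)
  fixσ i = R? i ×-dec (lookup σ i ≟ᶠ i)
  fixτ : ∀ j → Dec (R′ j × lookup τ j ≡ j)
  fixτ j = R′? j ×-dec (lookup τ j ≟ᶠ j)
  fixed : ∀ j → lookup σ (punchIn p j) ≡ punchIn p j ⇔ lookup τ j ≡ j
  fixed j = mk⇔ (λ e → punchIn-injective p _ _ (trans (sym (insertFix-punchIn p τ j)) e))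
                (λ e → trans (insertFix-punchIn p τ j) (cong (punchIn p) e))

∑𝟙-permute : ∀ {N} (τ : Map N) → IsPerm τ → {R : Pred (Fin N) 0ℓ} (R? : Decidable R) →
  ∑[ j < N ] 𝟙 (R? (lookup τ j)) ≡ ∑[ j < N ] 𝟙 (R? j)
∑𝟙-permute {N} τ τ-inj R? = squeeze (count-≤ R?) (count-≤ (¬? ∘ R?))
  (trans (∑𝟙+∑𝟙¬ (R? ∘ lookup τ)) (sym (∑𝟙+∑𝟙¬ R?)))
  where
  count-≤ : {S : Pred (Fin N) 0ℓ} (S? : Decidable S) → ∑[ j < N ] 𝟙 (S? (lookup τ j)) ≤ ∑[ j < N ] 𝟙 (S? j)
  count-≤ S? = subst₂ _≤_ (length-filter-tabulate (S? ∘ lookup τ) id) (length-filter-tabulate S? id)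
    (length-filter-≤ (S? ∘ lookup τ) S? (Unique.allFin⁺ N) ∈-allFin (lookup τ) id (λ _ _ → τ-inj _ _))
  squeeze : ∀ {a b c d} → a ≤ c → b ≤ d → a + b ≡ c + d → a ≡ c
  squeeze {a} {b} {c} {d} a≤c b≤d a+b≡c+d =
    ≤-antisym a≤c (+-cancelʳ-≤ d c a (≤-trans (≤-reflexive (sym a+b≡c+d)) (+-monoʳ-≤ a b≤d)))

𝟙-split : {A B : Set} (a? : Dec A) (b? : Dec B) → 𝟙 a? ≡ 𝟙 (a? ×-dec b?) + 𝟙 (a? ×-dec ¬? b?)
𝟙-split (yes _) (yes _) = refl
𝟙-split (yes _) (no _)  = refl
𝟙-split (no _)  _       = refl

𝟙-splitʳ : {A B : Set} (a? : Dec A) (b? : Dec B) → 𝟙 b? ≡ 𝟙 (a? ×-dec b?) + 𝟙 (¬? a? ×-dec b?)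
𝟙-splitʳ (yes _) (yes _) = refl
𝟙-splitʳ (no _)  (yes _) = refl
𝟙-splitʳ (yes _) (no _)  = refl
𝟙-splitʳ (no _)  (no _)  = refl

Inverted : ∀ {N} → Map N → Fin N → Fin N → Set
Inverted σ i j = toℕ i < toℕ j × toℕ (lookup σ j) < toℕ (lookup σ i)

inverted : ∀ {N} (σ : Map N) (i j : Fin N) → Dec (Inverted σ i j)
inverted σ i j = (i <ᶠ? j) ×-dec (lookup σ j <ᶠ? lookup σ i)

inversions≡∑∑ : ∀ {N} (σ : Map N) → inversions σ ≡ ∑[ i < N ] ∑[ j < N ] 𝟙 (inverted σ i j)
inversions≡∑∑ {N} σ = trans (length-filter-concatMap inverted² (λ i → map (i ,_) (allFin N)) id)
  (sum-cong-≗ {N} λ i → trans (cong (length ∘ filter inverted²) (map-tabulate id (i ,_)))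
                              (length-filter-tabulate inverted² (i ,_)))
  where
  inverted² : (q : Fin N × Fin N) → Dec (Inverted σ (proj₁ q) (proj₂ q))
  inverted² (i , j) = inverted σ i j

toℕ-<-cong : ∀ {n} {a a′ b b′ : Fin n} → a ≡ a′ → b ≡ b′ → toℕ a < toℕ b ⇔ toℕ a′ < toℕ b′
toℕ-<-cong refl refl = mk⇔ id id

module _ {N} (p : Fin (suc N)) (τ : Map N) where
  private
    σ = insertFix p τ
    below : (j : Fin N) → Dec (toℕ j < toℕ p)
    below j = toℕ j <? toℕ p
    τ-below : (j : Fin N) → Dec (toℕ (lookup τ j) < toℕ p)
    τ-below j = toℕ (lookup τ j) <? toℕ p
    crossesDown crossesUp : Fin N → ℕ
    crossesDown j = 𝟙 (¬? (below j) ×-dec τ-below j)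
    crossesUp j = 𝟙 (below j ×-dec ¬? (τ-below j))

  -- The inversions of σ through p are the pairs (p, j) with τ j crossing p downwards
  -- and the pairs (i, p) with τ i crossing p upwards.
  inversions-insertFix : inversions σ ≡ ∑[ j < N ] crossesDown j + (∑[ i < N ] crossesUp i + inversions τ)
  inversions-insertFix = begin
    inversions σ                                          ≡⟨ inversions≡∑∑ σ ⟩
    ∑[ i < suc N ] ∑[ j < suc N ] 𝟙 (inverted σ i j)
      ≡⟨ sum-remove {i = p} (λ i → ∑[ j < suc N ] 𝟙 (inverted σ i j)) ⟩
    ∑[ j < suc N ] 𝟙 (inverted σ p j) + ∑[ i < N ] ∑[ j < suc N ] 𝟙 (inverted σ (punchIn p i) j)
      ≡⟨ cong₂ _+_ (sum-remove {i = p} (𝟙 ∘ inverted σ p))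
                   (sum-cong-≗ {N} λ i → sum-remove {i = p} (𝟙 ∘ inverted σ (punchIn p i))) ⟩
    (𝟙 (inverted σ p p) + ∑[ j < N ] 𝟙 (inverted σ p (punchIn p j)))
      + ∑[ i < N ] (𝟙 (inverted σ (punchIn p i) p) + ∑[ j < N ] 𝟙 (inverted σ (punchIn p i) (punchIn p j)))
      ≡⟨ cong₂ _+_ (cong₂ _+_ pivot-pivot (sum-cong-≗ {N} pivot-row))
                   (sum-cong-≗ {N} λ i → cong₂ _+_ (pivot-column i) (sum-cong-≗ {N} (off-pivot i))) ⟩
    ∑[ j < N ] crossesDown j + ∑[ i < N ] (crossesUp i + ∑[ j < N ] 𝟙 (inverted τ i j))
      ≡⟨ cong (∑[ j < N ] crossesDown j +_) (∑-distrib-+ crossesUp _) ⟩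
    ∑[ j < N ] crossesDown j + (∑[ i < N ] crossesUp i + ∑[ i < N ] ∑[ j < N ] 𝟙 (inverted τ i j))
      ≡⟨ cong (λ k → ∑[ j < N ] crossesDown j + (∑[ i < N ] crossesUp i + k)) (inversions≡∑∑ τ) ⟨
    ∑[ j < N ] crossesDown j + (∑[ i < N ] crossesUp i + inversions τ) ∎
    where
    open ≡-Reasoning
    pivot-pivot : 𝟙 (inverted σ p p) ≡ 0
    pivot-pivot = 𝟙-no (inverted σ p p) λ (p<p , _) → <-irrefl refl p<p
    pivot-row : ∀ j → 𝟙 (inverted σ p (punchIn p j)) ≡ crossesDown j
    pivot-row j = 𝟙-cong (pivot-<-punchIn p j ×-⇔
      ⇔-trans (toℕ-<-cong (insertFix-punchIn p τ j) (insertFix-pivot p τ)) (punchIn-<-pivot p (lookup τ j))) _ _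
    pivot-column : ∀ i → 𝟙 (inverted σ (punchIn p i) p) ≡ crossesUp i
    pivot-column i = 𝟙-cong (punchIn-<-pivot p i ×-⇔
      ⇔-trans (toℕ-<-cong (insertFix-pivot p τ) (insertFix-punchIn p τ i)) (pivot-<-punchIn p (lookup τ i))) _ _
    off-pivot : ∀ i j → 𝟙 (inverted σ (punchIn p i) (punchIn p j)) ≡ 𝟙 (inverted τ i j)
    off-pivot i j = 𝟙-cong (punchIn-<-punchIn p i j ×-⇔
      ⇔-trans (toℕ-<-cong (insertFix-punchIn p τ j) (insertFix-punchIn p τ i)) (punchIn-<-punchIn p _ _)) _ _

  -- τ maps as many points below p as there are points below p; discount those staying below.
  ∑crossesDown≡∑crossesUp : IsPerm τ → ∑[ j < N ] crossesDown j ≡ ∑[ i < N ] crossesUp i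
  ∑crossesDown≡∑crossesUp τ-inj = +-cancelˡ-≡ (∑[ j < N ] stays j) _ _ (begin
    ∑[ j < N ] stays j + ∑[ j < N ] crossesDown j ≡⟨ ∑-distrib-+ stays crossesDown ⟨
    ∑[ j < N ] (stays j + crossesDown j)          ≡⟨ sum-cong-≗ {N} (λ j → 𝟙-splitʳ (below j) (τ-below j)) ⟨
    ∑[ j < N ] 𝟙 (τ-below j)                      ≡⟨ ∑𝟙-permute τ τ-inj (λ k → toℕ k <? toℕ p) ⟩
    ∑[ j < N ] 𝟙 (below j)                        ≡⟨ sum-cong-≗ {N} (λ j → 𝟙-split (below j) (τ-below j)) ⟩
    ∑[ j < N ] (stays j + crossesUp j)            ≡⟨ ∑-distrib-+ stays crossesUp ⟩
    ∑[ j < N ] stays j + ∑[ j < N ] crossesUp j ∎)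
    where
    open ≡-Reasoning
    stays : Fin N → ℕ
    stays j = 𝟙 (below j ×-dec τ-below j)

  parity-insertFix : IsPerm τ → parity σ ≡ parity τ
  parity-insertFix τ-inj = begin
    inversions σ % 2                                   ≡⟨ cong (_% 2) inversions-insertFix ⟩
    (∑[ j < N ] crossesDown j + (∑[ i < N ] crossesUp i + inversions τ)) % 2
      ≡⟨ cong (λ k → (k + (∑[ i < N ] crossesUp i + inversions τ)) % 2) (∑crossesDown≡∑crossesUp τ-inj) ⟩
    (∑[ i < N ] crossesUp i + (∑[ i < N ] crossesUp i + inversions τ)) % 2
      ≡⟨ cong (_% 2) (twice (∑[ i < N ] crossesUp i) (inversions τ)) ⟩
    (inversions τ + ∑[ i < N ] crossesUp i * 2) % 2
      ≡⟨ [m+kn]%n≡m%n (inversions τ) (∑[ i < N ] crossesUp i) 2 ⟩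
    inversions τ % 2 ∎
    where
    open ≡-Reasoning
    twice : ∀ a b → a + (a + b) ≡ b + a * 2
    twice = solve-∀

-- Counting 𝒟_{r,u,m}(n)

countFixing : ∀ {N} {P : Pred (Map N) 0ℓ} → Decidable P → Fin N → ℕ
countFixing {N} P? p = length (filter (λ σ → P? σ ×-dec (lookup σ p ≟ᶠ p)) (allMaps N))

double-count-fixed : ∀ {N} {R : Pred (Fin N) 0ℓ} (R? : Decidable R) {P : Pred (Map N) 0ℓ} (P? : Decidable P)
  (k X : ℕ) → (∀ {σ} → P σ → fixedIn R? σ ≡ k) →
  (∀ p → R p → countFixing P? p ≡ X) →
  k * length (filter P? (allMaps N)) ≡ (∑[ p < N ] 𝟙 (R? p)) * X
double-count-fixed {N} {R} R? {P} P? k X fixed-k fixing-p = begin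
  k * length (filter P? (allMaps N))
    ≡⟨ double-count P? (λ p σ → R? p ×-dec (lookup σ p ≟ᶠ p)) k
         (λ {σ} Pσ → trans (sym (length-filter-tabulate (λ i → R? i ×-dec (lookup σ i ≟ᶠ i)) id)) (fixed-k Pσ))
         (allMaps N) ⟩
  ∑[ p < N ] length (filter (λ σ → P? σ ×-dec (R? p ×-dec (lookup σ p ≟ᶠ p))) (allMaps N))
    ≡⟨ sum-cong-≗ {N} per-pivot ⟩
  ∑[ p < N ] (𝟙 (R? p) * X) ≡⟨ *-distribʳ-sum X (𝟙 ∘ R?) ⟨
  (∑[ p < N ] 𝟙 (R? p)) * X ∎
  where
  open ≡-Reasoning
  per-pivot : ∀ p → length (filter (λ σ → P? σ ×-dec (R? p ×-dec (lookup σ p ≟ᶠ p))) (allMaps N)) ≡ 𝟙 (R? p) * X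
  per-pivot p with R? p
  ... | yes Rp = trans (cong length (filter-≐ _ _ drop-Rp (allMaps N))) (trans (fixing-p p Rp) (sym (*-identityˡ X)))
    where
    drop-Rp : (λ σ → P σ × R p × lookup σ p ≡ p) ≐ (λ σ → P σ × lookup σ p ≡ p)
    drop-Rp = (λ (Pσ , _ , σp≡p) → Pσ , σp≡p) , (λ (Pσ , σp≡p) → Pσ , Rp , σp≡p)
  ... | no ¬Rp = cong length (filter-none _ (universal (λ σ → ¬Rp ∘ proj₁ ∘ proj₂) (allMaps N)))

[k+1]*[n+1]C[k+1]≡[n+1]*nCk : ∀ n k → suc k * (suc n C suc k) ≡ suc n * (n C k)
[k+1]*[n+1]C[k+1]≡[n+1]*nCk zero    zero    = refl
[k+1]*[n+1]C[k+1]≡[n+1]*nCk zero    (suc k) = *-zeroʳ (suc (suc k))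
[k+1]*[n+1]C[k+1]≡[n+1]*nCk (suc n) zero    = trans (*-identityˡ _) (trans (nC1≡n (suc (suc n))) (sym (*-identityʳ _)))
[k+1]*[n+1]C[k+1]≡[n+1]*nCk (suc n) (suc k) = begin
  suc K * (suc (suc n) C suc K)                     ≡⟨ cong (suc K *_) (nCk+nC[k+1]≡[n+1]C[k+1] (suc n) K) ⟨
  suc K * (suc n C K + suc n C suc K)               ≡⟨ *-distribˡ-+ (suc K) (suc n C K) _ ⟩
  suc n C K + K * (suc n C K) + suc K * (suc n C suc K)
    ≡⟨ cong₂ (λ a b → suc n C K + a + b) ([k+1]*[n+1]C[k+1]≡[n+1]*nCk n k) ([k+1]*[n+1]C[k+1]≡[n+1]*nCk n K) ⟩
  suc n C K + suc n * (n C k) + suc n * (n C K)     ≡⟨ regroup (suc n C K) (suc n) (n C k) (n C K) ⟩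
  suc n C K + suc n * (n C k + n C K)
    ≡⟨ cong (λ c → suc n C K + suc n * c) (nCk+nC[k+1]≡[n+1]C[k+1] n k) ⟩
  suc (suc n) * (suc n C K) ∎
  where
  open ≡-Reasoning
  K = suc k
  regroup : ∀ a b c d → a + b * c + b * d ≡ a + b * (c + d)
  regroup = solve-∀

-- InD with the size N of the ground set left free: InD r u m n is InD′ r u m at N = r + n.
InD′ : ∀ {N} → ℕ → ℕ → ℕ → Map N → Set
InD′ r u m σ = IsPerm σ × Separated r σ × fixedLow r σ ≡ u × fixedHigh r σ ≡ m

inD′? : ∀ {N} r u m (σ : Map N) → Dec (InD′ r u m σ)
inD′? r u m σ = isPerm? σ ×-dec separated? r σ ×-dec (fixedLow r σ ≟ u) ×-dec (fixedHigh r σ ≟ m)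

-- Counts the σ ∈ 𝒟 satisfying an extra condition Q that survives inserting a fixed point:
-- Q = ⊤ gives D, and Q σ = (parity σ ≡ i) gives D^{(i)}.
module Counting {Q : ∀ {N} → Map N → Set} (Q? : ∀ {N} (σ : Map N) → Dec (Q σ))
  (Q-insertFix : ∀ {N} (p : Fin (suc N)) (τ : Map N) → IsPerm τ → Q (insertFix p τ) ⇔ Q τ) where

  Counted : ∀ {N} → ℕ → ℕ → ℕ → Map N → Set
  Counted r u m σ = InD′ r u m σ × Q σ

  counted? : ∀ {N} r u m (σ : Map N) → Dec (Counted r u m σ)
  counted? r u m σ = inD′? r u m σ ×-dec Q? σ

  count : ℕ → ℕ → ℕ → ℕ → ℕ
  count N r u m = length (filter (counted? r u m) (allMaps N))

  module _ {N} (p : Fin (suc N)) {r r′ u u′ m m′ : ℕ} (shift : ∀ j → toℕ (punchIn p j) < r ⇔ toℕ j < r′)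
           (u≡ : u ≡ 𝟙 (toℕ p <? r) + u′) (m≡ : m ≡ 𝟙 (¬? (toℕ p <? r)) + m′) where

    insertFix-counted : ∀ τ → Counted r u m (insertFix p τ) ⇔ Counted r′ u′ m′ τ
    insertFix-counted τ = mk⇔
      (λ ((σ-perm , σ-sep , σ-low , σ-high) , Qσ) → let τ-perm = Equivalence.to (insertFix-isPerm p τ) σ-perm in
        (τ-perm , Equivalence.to (insertFix-separated p τ shift) σ-sep ,
         Equivalence.to low σ-low , Equivalence.to high σ-high) , Equivalence.to (Q-insertFix p τ τ-perm) Qσ)
      (λ ((τ-perm , τ-sep , τ-low , τ-high) , Qτ) →
        (Equivalence.from (insertFix-isPerm p τ) τ-perm , Equivalence.from (insertFix-separated p τ shift) τ-sep ,
         Equivalence.from low τ-low , Equivalence.from high τ-high) , Equivalence.from (Q-insertFix p τ τ-perm) Qτ)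
      where
      cancel-⇔ : ∀ {a a′ b b′} k → a ≡ k + a′ → b ≡ k + b′ → (a ≡ b) ⇔ (a′ ≡ b′)
      cancel-⇔ k a≡ b≡ = mk⇔ (λ a≡b → +-cancelˡ-≡ k _ _ (trans (sym a≡) (trans a≡b b≡)))
                             (λ a′≡b′ → trans a≡ (trans (cong (k +_) a′≡b′) (sym b≡)))
      low : (fixedLow r (insertFix p τ) ≡ u) ⇔ (fixedLow r′ τ ≡ u′)
      low = cancel-⇔ _ (fixedIn-insertFix p τ (λ i → toℕ i <? r) (λ j → toℕ j <? r′) shift) u≡
      high : (fixedHigh r (insertFix p τ) ≡ m) ⇔ (fixedHigh r′ τ ≡ m′)
      high = cancel-⇔ _ (fixedIn-insertFix p τ (λ i → ¬? (toℕ i <? r)) (λ j → ¬? (toℕ j <? r′))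
               (λ j → mk⇔ (λ ¬pj<r j<r′ → ¬pj<r (Equivalence.from (shift j) j<r′))
                          (λ ¬j<r′ pj<r → ¬j<r′ (Equivalence.to (shift j) pj<r)))) m≡

    countFixing≡count : countFixing (counted? r u m) p ≡ count N r′ u′ m′
    countFixing≡count = length-filter-bijection _ (counted? r′ u′ m′)
      (tables-unique (suc N) (suc N)) (tables-unique N N) tables-complete tables-complete
      (deleteFix p) (insertFix p)
      (λ {σ} (Cσ , σp≡p) → Equivalence.to (insertFix-counted (deleteFix p σ))
         (subst (Counted r u m) (sym (insertFix-deleteFix p σ (proj₁ (proj₁ Cσ)) σp≡p)) Cσ))
      (λ {τ} Cτ → Equivalence.from (insertFix-counted τ) Cτ , insertFix-pivot p τ)
      (λ {σ} (Cσ , σp≡p) → insertFix-deleteFix p σ (proj₁ (proj₁ Cσ)) σp≡p)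
      (λ {τ} _ → deleteFix-insertFix p τ)

  countFixing-below : ∀ {N r u m} (p : Fin N) → toℕ p < r →
    countFixing (counted? r (suc u) m) p ≡ count (pred N) (pred r) u m
  countFixing-below {suc N} {suc r} {u} {m} p p<1+r = countFixing≡count p (λ j → punchIn-<-below p j p<1+r)
    (cong (_+ u) (sym (𝟙-yes (toℕ p <? suc r) p<1+r)))
    (cong (_+ m) (sym (𝟙-no (¬? (toℕ p <? suc r)) (λ p≮1+r → p≮1+r p<1+r))))

  countFixing-above : ∀ {N r u m} (p : Fin N) → ¬ toℕ p < r →
    countFixing (counted? r u (suc m)) p ≡ count (pred N) r u m
  countFixing-above {suc N} {r} {u} {m} p p≮r = countFixing≡count p (λ j → punchIn-<-above p j (≮⇒≥ p≮r))
    (cong (_+ u) (sym (𝟙-no (toℕ p <? r) p≮r)))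
    (cong (_+ m) (sym (𝟙-yes (¬? (toℕ p <? r)) p≮r)))

  count-low-recurrence : ∀ N r u m → r ≤ N → suc u * count N r (suc u) m ≡ r * count (pred N) (pred r) u m
  count-low-recurrence N r u m r≤N = trans
    (double-count-fixed {N} (λ i → toℕ i <? r) (counted? r (suc u) m) (suc u) (count (pred N) (pred r) u m)
       (λ ((_ , _ , low , _) , _) → low) (λ p → countFixing-below {N} {r} {u} {m} p))
    (cong (_* count (pred N) (pred r) u m) (∑𝟙-<-toℕ r r≤N))

  count-high-recurrence : ∀ N r u m → r ≤ N → suc m * count N r u (suc m) ≡ (N ∸ r) * count (pred N) r u m
  count-high-recurrence N r u m r≤N = trans
    (double-count-fixed {N} (λ i → ¬? (toℕ i <? r)) (counted? r u (suc m)) (suc m) (count (pred N) r u m)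
       (λ ((_ , _ , _ , high) , _) → high) (λ p → countFixing-above {N} {r} {u} {m} p))
    (cong (_* count (pred N) r u m) (begin
      ∑[ i < N ] 𝟙 (¬? (toℕ i <? r))                                ≡⟨ m+n∸m≡n r _ ⟨
      r + ∑[ i < N ] 𝟙 (¬? (toℕ i <? r)) ∸ r
        ≡⟨ cong (λ k → k + ∑[ i < N ] 𝟙 (¬? (toℕ i <? r)) ∸ r) (∑𝟙-<-toℕ r r≤N) ⟨
      ∑[ i < N ] 𝟙 (toℕ i <? r) + ∑[ i < N ] 𝟙 (¬? (toℕ i <? r)) ∸ r
        ≡⟨ cong (_∸ r) (∑𝟙+∑𝟙¬ (λ i → toℕ i <? r)) ⟩
      N ∸ r ∎))
    where open ≡-Reasoning

  count-high-recurrence′ : ∀ r n u m → suc m * count (r + suc n) r u (suc m) ≡ suc n * count (r + n) r u m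
  count-high-recurrence′ r n u m = trans (count-high-recurrence (r + suc n) r u m (m≤m+n r (suc n)))
    (cong₂ (λ k N → k * count (pred N) r u m) (m+n∸m≡n r (suc n)) (+-suc r n))

  count-low-vacuous : ∀ n u m → count n 0 (suc u) m ≡ 0
  count-low-vacuous n u m = *-cancelˡ-≡ _ 0 (suc u)
    (trans (count-low-recurrence n 0 u m z≤n) (sym (*-zeroʳ (suc u))))

  count-high-vacuous : ∀ r u m → count (r + 0) r u (suc m) ≡ 0
  count-high-vacuous r u m = *-cancelˡ-≡ _ 0 (suc m)
    (trans (count-high-recurrence (r + 0) r u m (m≤m+n r 0))
      (trans (cong (_* count (pred (r + 0)) r u m) (m+n∸m≡n r 0)) (sym (*-zeroʳ (suc m)))))

  count-closed : ∀ u m r n → count (r + n) r u m ≡ (r C u) * (n C m) * count ((r ∸ u) + (n ∸ m)) (r ∸ u) 0 0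
  count-closed zero    zero    r       n       = sym (+-identityʳ _)
  count-closed (suc u) m       zero    n       = count-low-vacuous n u m
  count-closed zero    (suc m) r       zero    = count-high-vacuous r 0 m
  count-closed (suc u) m       (suc r) n       = *-cancelˡ-≡ _ _ (suc u) (begin
    suc u * count (suc r + n) (suc r) (suc u) m ≡⟨ count-low-recurrence (suc r + n) (suc r) u m (m≤m+n (suc r) n) ⟩
    suc r * count (r + n) r u m                 ≡⟨ cong (suc r *_) (count-closed u m r n) ⟩
    suc r * ((r C u) * (n C m) * X)             ≡⟨ reassoc (suc r) (r C u) (n C m) X ⟩
    suc r * (r C u) * (n C m) * X               ≡⟨ cong (λ c → c * (n C m) * X) ([k+1]*[n+1]C[k+1]≡[n+1]*nCk r u) ⟨
    suc u * (suc r C suc u) * (n C m) * X       ≡⟨ reassoc (suc u) (suc r C suc u) (n C m) X ⟨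
    suc u * ((suc r C suc u) * (n C m) * X) ∎)
    where
    open ≡-Reasoning
    X = count ((r ∸ u) + (n ∸ m)) (r ∸ u) 0 0
    reassoc : ∀ a b c d → a * (b * c * d) ≡ a * b * c * d
    reassoc = solve-∀
  count-closed zero    (suc m) r       (suc n) = *-cancelˡ-≡ _ _ (suc m) (begin
    suc m * count (r + suc n) r 0 (suc m)       ≡⟨ count-high-recurrence′ r n 0 m ⟩
    suc n * count (r + n) r 0 m                 ≡⟨ cong (suc n *_) (count-closed 0 m r n) ⟩
    suc n * ((r C 0) * (n C m) * X)             ≡⟨ reassoc (suc n) (r C 0) (n C m) X ⟩
    (r C 0) * (suc n * (n C m)) * X
      ≡⟨ cong (λ c → (r C 0) * c * X) ([k+1]*[n+1]C[k+1]≡[n+1]*nCk n m) ⟨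
    (r C 0) * (suc m * (suc n C suc m)) * X     ≡⟨ reassoc (suc m) (r C 0) (suc n C suc m) X ⟨
    suc m * ((r C 0) * (suc n C suc m) * X) ∎)
    where
    open ≡-Reasoning
    X = count (r + (n ∸ m)) r 0 0
    reassoc : ∀ a b c d → a * (b * c * d) ≡ b * (a * c) * d
    reassoc = solve-∀

module Unrestricted = Counting (λ _ → yes tt) (λ _ _ _ → mk⇔ (λ _ → tt) (λ _ → tt))
module OfParity (i : ℕ) = Counting (λ σ → parity σ ≟ i)
  (λ p τ τ-perm → mk⇔ (trans (sym (parity-insertFix p τ τ-perm))) (trans (parity-insertFix p τ τ-perm)))

D≡count : ∀ r u m n → D r u m n ≡ Unrestricted.count (r + n) r u m
D≡count r u m n =
  cong length (filter-≐ (inD? r u m n) (Unrestricted.counted? r u m) ((_, tt) , proj₁) (allMaps (r + n)))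

proposition6p1 : (r u m n : ℕ) →
    (D r u m n ≡ (r C u) * (n C m) * Dr (r ∸ u) (n ∸ m))
    × ((i : ℕ) → i < 2 → Dpar i r u m n ≡ (r C u) * (n C m) * Drpar i (r ∸ u) (n ∸ m))
proposition6p1 r u m n =
  trans (D≡count r u m n) (trans (Unrestricted.count-closed u m r n)
    (cong ((r C u) * (n C m) *_) (sym (D≡count (r ∸ u) 0 0 (n ∸ m))))) ,
  -- the parity identity holds for every i
  λ i _ → OfParity.count-closed i u m r n
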